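{- Let $f_0(n)=\binom{2n-2}{n-1}$ for $n=1,2,\ldots$ and let $1\le k\le n$. Then $c_1(n,k)$ equals the number of words of length $2n-k-1$ over the alphabet $\{0,1,2\}$ having exactly $k-1$ letters equal to $2$ and such that every maximal binary subword (each maximal block of consecutive letters from $\{0,1\}$, including empty blocks before the first $2$, between consecutive $2$'s, and after the last $2$) contains equally many zeros and ones.
   Context: $c_1(n,k)=\sum_{i_1+\cdots+i_k=n} f_{0}(i_1)\cdots f_{0}(i_k)$, the sum over all $k$-tuples of positive integers $(i_1,\ldots,i_k)$ with sum $n$. -}

module Defs where

open import Data.Nat using (ℕ; zero; suc; _+_; _*_; _∸_; _≟_)
open import Data.Nat.Combinatorics using (_C_)
open import Data.Nat.ListAction using (sum; product)
open import Data.List using (List; []; _∷_; map; concatMap; length; filter; upTo; replicate)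
open import Data.List.Relation.Unary.All using (All; all?)
open import Data.Fin using (Fin; zero; suc)
open import Data.Product using (_×_; _,_)
open import Relation.Nullary using (Dec)
open import Relation.Nullary.Decidable using (_×-dec_)
open import Relation.Binary.PropositionalEquality using (_≡_)

f₀ : ℕ → ℕ
f₀ n = (2 * n ∸ 2) C (n ∸ 1)

compositions : ℕ → ℕ → List (List ℕ)
compositions zero    zero    = [] ∷ []
compositions (suc _) zero    = []
compositions n       (suc k) =
  concatMap (λ j → map (suc j ∷_) (compositions (n ∸ suc j) k))
            (filter (λ j → suc j Data.Nat.≤? n) (upTo n))

c₁ : ℕ → ℕ → ℕ
c₁ n k = sum (map (λ is → product (map f₀ is)) (compositions n k))

Letter : Set
Letter = Fin 3

words : ℕ → List (List Letter)
words zero    = [] ∷ []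
words (suc m) = concatMap (λ w → (zero ∷ w) ∷ (suc zero ∷ w) ∷ (suc (suc zero) ∷ w) ∷ []) (words m)

count : Letter → List Letter → ℕ
count a [] = 0
count a (b ∷ w) with a Data.Fin.≟ b
... | Relation.Nullary.yes _ = suc (count a w)
... | Relation.Nullary.no  _ = count a w

-- maximal binary subwords: split at every letter 2 (empty blocks included);
-- a word with j letters 2 has exactly j+1 blocks
blocks : List Letter → List (List Letter)
blocks [] = [] ∷ []
blocks (suc (suc zero) ∷ w) = [] ∷ blocks w
blocks (a ∷ w) with blocks w
... | []       = (a ∷ []) ∷ []
... | (b ∷ bs) = (a ∷ b) ∷ bs

Balanced : List Letter → Set
Balanced u = count zero u ≡ count (suc zero) u

balanced? : (u : List Letter) → Dec (Balanced u)
balanced? u = count zero u ≟ count (suc zero) u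

Good : ℕ → List Letter → Set
Good k w = (count (suc (suc zero)) w ≡ k ∸ 1) × All Balanced (blocks w)

good? : (k : ℕ) (w : List Letter) → Dec (Good k w)
good? k w = (count (suc (suc zero)) w ≟ k ∸ 1) ×-dec all? balanced? (blocks w)

numGoodWords : ℕ → ℕ → ℕ
numGoodWords k m = length (filter (good? k) (words m))

-- A good word with k − 1 letters 2 splits as B₁ 2 B₂ 2 ⋯ 2 B_k into balanced blocks,
-- and a balanced block of length 2(i − 1) can be filled in binom(2i − 2, i − 1) = f₀(i)
-- ways; since the lengths force i₁ + ⋯ + i_k = n, both sides obey the recursion of
-- c₁ n (k + 1) in the size of the first part.  To count words by their head block we
-- read letters one at a time while tracking its profile (a zeros, b ones): each letter
-- lowers a or b, so the count of words with a given head-block profile is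
-- binom(a + b, a) times the count of what follows the head block (Pascal's rule).
module Submission where

open import Defs
open import Data.Bool using (Bool; true; false; _∧_; T)
open import Data.Bool.Properties using (∧-zeroʳ; ∧-comm; ∧-assoc; T-∧)
open import Data.Empty using (⊥; ⊥-elim)
open import Data.Fin using (zero; suc)
open import Data.List using (List; []; _∷_; _++_; map; concatMap; length; filter; applyUpTo; upTo)
open import Data.List.Properties using (map-++; filter-all)
open import Data.List.Relation.Unary.All using (all?)
open import Data.List.Relation.Unary.All.Properties using (all-upTo)
open import Data.Nat using (ℕ; zero; suc; _+_; _*_; _∸_; _≤_; _<_; _≤?_; _≡ᵇ_; z≤n; s≤s; z<s; s<s)
open import Data.Nat.Combinatorics using (_C_; nCn≡1; nCk+nC[k+1]≡[n+1]C[k+1])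
open import Data.Nat.ListAction using (sum; product)
open import Data.Nat.ListAction.Properties using (sum-++)
open import Data.Nat.Properties
open import Data.Nat.Tactic.RingSolver using (solve-∀)
open import Data.Product using (_,_)
open import Function using (_∘_)
open import Function.Bundles using (Equivalence)
open import Relation.Nullary using (does)
open import Relation.Unary using (Decidable)
open import Relation.Binary.PropositionalEquality
open ≡-Reasoning

pattern 𝟘 = zero
pattern 𝟙 = suc zero
pattern 𝟚 = suc (suc zero)

⟦_⟧ : Bool → ℕ
⟦ true  ⟧ = 1
⟦ false ⟧ = 0

⟦⟧≡0 : ∀ {x} → (T x → ⊥) → ⟦ x ⟧ ≡ 0
⟦⟧≡0 {true}  ¬x = ⊥-elim (¬x _)
⟦⟧≡0 {false} _  = refl

sumBelow : ℕ → (ℕ → ℕ) → ℕ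
sumBelow zero    f = 0
sumBelow (suc n) f = f 0 + sumBelow n (f ∘ suc)

infix 5 sumBelow
syntax sumBelow n (λ i → e) = ∑[ i < n ] e

∑-cong : ∀ n {f g : ℕ → ℕ} → (∀ {i} → i < n → f i ≡ g i) → ∑[ i < n ] f i ≡ ∑[ i < n ] g i
∑-cong zero    f≡g = refl
∑-cong (suc n) f≡g = cong₂ _+_ (f≡g z<s) (∑-cong n (f≡g ∘ s<s))

∑-vanish : ∀ n {f : ℕ → ℕ} → (∀ {i} → i < n → f i ≡ 0) → ∑[ i < n ] f i ≡ 0
∑-vanish zero    f≡0 = refl
∑-vanish (suc n) f≡0 = cong₂ _+_ (f≡0 z<s) (∑-vanish n (f≡0 ∘ s<s))

∑-truncate : ∀ {n M} (f : ℕ → ℕ) → n ≤ M → (∀ {i} → n ≤ i → i < M → f i ≡ 0) →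
             ∑[ i < M ] f i ≡ ∑[ i < n ] f i
∑-truncate {zero}  {M}     f _         f≡0 = ∑-vanish M (f≡0 z≤n)
∑-truncate {suc n} {suc M} f (s≤s n≤M) f≡0 =
  cong (f 0 +_) (∑-truncate (f ∘ suc) n≤M (λ n≤i i<M → f≡0 (s≤s n≤i) (s≤s i<M)))

∑-delta : ∀ M x (b : ℕ → Bool) → x < M → ∑[ a < M ] ⟦ (x ≡ᵇ a) ∧ b a ⟧ ≡ ⟦ b x ⟧
∑-delta (suc M) zero    b _         =
  trans (cong (⟦ b 0 ⟧ +_) (∑-vanish M (λ _ → refl))) (+-identityʳ ⟦ b 0 ⟧)
∑-delta (suc M) (suc x) b (s≤s x<M) = ∑-delta M x (b ∘ suc) x<M

sumWords : ℕ → (List Letter → ℕ) → ℕ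
sumWords zero    F = F []
sumWords (suc m) F = sumWords m (λ w → F (𝟘 ∷ w) + F (𝟙 ∷ w) + F (𝟚 ∷ w))

sumWords-cong : ∀ m {F G : List Letter → ℕ} → (∀ w → length w ≡ m → F w ≡ G w) →
                sumWords m F ≡ sumWords m G
sumWords-cong zero    F≡G = F≡G [] refl
sumWords-cong (suc m) F≡G = sumWords-cong m λ w len →
  let F≡G′ = λ ℓ → F≡G (ℓ ∷ w) (cong suc len) in
  cong₂ _+_ (cong₂ _+_ (F≡G′ 𝟘) (F≡G′ 𝟙)) (F≡G′ 𝟚)

sumWords-zero : ∀ m → sumWords m (λ _ → 0) ≡ 0
sumWords-zero zero    = refl
sumWords-zero (suc m) = sumWords-zero m

sumWords-+ : ∀ m (F G : List Letter → ℕ) →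
             sumWords m (λ w → F w + G w) ≡ sumWords m F + sumWords m G
sumWords-+ zero    F G = refl
sumWords-+ (suc m) F G = trans
  (sumWords-cong m λ w _ →
    +-interchange₃ (F (𝟘 ∷ w)) (F (𝟙 ∷ w)) (F (𝟚 ∷ w)) (G (𝟘 ∷ w)) (G (𝟙 ∷ w)) (G (𝟚 ∷ w)))
  (sumWords-+ m _ _)
  where +-interchange₃ : ∀ a b c d e f → a + d + (b + e) + (c + f) ≡ a + b + c + (d + e + f)
        +-interchange₃ = solve-∀

sumWords-suc : ∀ m (F : List Letter → ℕ) →
  sumWords (suc m) F ≡ sumWords m (F ∘ (𝟘 ∷_)) + sumWords m (F ∘ (𝟙 ∷_)) + sumWords m (F ∘ (𝟚 ∷_))
sumWords-suc m F = trans (sumWords-+ m (λ w → F (𝟘 ∷ w) + F (𝟙 ∷ w)) (F ∘ (𝟚 ∷_)))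
  (cong (_+ sumWords m (F ∘ (𝟚 ∷_))) (sumWords-+ m (F ∘ (𝟘 ∷_)) (F ∘ (𝟙 ∷_))))

sumWords-∑ : ∀ m M (G : ℕ → List Letter → ℕ) →
             sumWords m (λ w → ∑[ a < M ] G a w) ≡ ∑[ a < M ] sumWords m (G a)
sumWords-∑ m zero    G = sumWords-zero m
sumWords-∑ m (suc M) G = trans (sumWords-+ m _ _) (cong (_ +_) (sumWords-∑ m M (G ∘ suc)))

sum-map-concatMap : ∀ {A B : Set} (F : B → ℕ) (g : A → List B) (xs : List A) →
                    sum (map F (concatMap g xs)) ≡ sum (map (λ x → sum (map F (g x))) xs)
sum-map-concatMap F g []       = refl
sum-map-concatMap F g (x ∷ xs) = begin
  sum (map F (g x ++ concatMap g xs))              ≡⟨ cong sum (map-++ F (g x) _) ⟩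
  sum (map F (g x) ++ map F (concatMap g xs))      ≡⟨ sum-++ (map F (g x)) _ ⟩
  sum (map F (g x)) + sum (map F (concatMap g xs)) ≡⟨ cong (_ +_) (sum-map-concatMap F g xs) ⟩
  sum (map F (g x)) + sum (map (λ x → sum (map F (g x))) xs) ∎

sum-words : ∀ m (F : List Letter → ℕ) → sum (map F (words m)) ≡ sumWords m F
sum-words zero    F = +-identityʳ (F [])
sum-words (suc m) F = begin
  sum (map F (words (suc m))) ≡⟨ sum-map-concatMap F _ (words m) ⟩
  sum (map F′ (words m))      ≡⟨ sum-words m F′ ⟩
  sumWords m F′               ≡⟨ sumWords-cong m (λ w _ → assoc (F (𝟘 ∷ w)) (F (𝟙 ∷ w)) (F (𝟚 ∷ w))) ⟩
  sumWords (suc m) F          ∎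
  where
  F′ : List Letter → ℕ
  F′ w = F (𝟘 ∷ w) + (F (𝟙 ∷ w) + (F (𝟚 ∷ w) + 0))
  assoc : ∀ a b c → a + (b + (c + 0)) ≡ a + b + c
  assoc = solve-∀

length-filter≡sum : ∀ {A : Set} {P : A → Set} (P? : Decidable P) (xs : List A) →
                    length (filter P? xs) ≡ sum (map (λ x → ⟦ does (P? x) ⟧) xs)
length-filter≡sum P? []       = refl
length-filter≡sum P? (x ∷ xs) with does (P? x)
... | true  = cong suc (length-filter≡sum P? xs)
... | false = length-filter≡sum P? xs

numGoodWords-sumWords : ∀ k m → numGoodWords k m ≡ sumWords m (λ w → ⟦ does (good? k w) ⟧)
numGoodWords-sumWords k m = trans (length-filter≡sum (good? k) (words m)) (sum-words m _)

zeros ones twos : List Letter → ℕ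
zeros = count 𝟘
ones  = count 𝟙
twos  = count 𝟚

headBlock : List Letter → List Letter
headBlock []      = []
headBlock (𝟘 ∷ w) = 𝟘 ∷ headBlock w
headBlock (𝟙 ∷ w) = 𝟙 ∷ headBlock w
headBlock (𝟚 ∷ w) = []

tailBlocks : List Letter → List (List Letter)
tailBlocks []      = []
tailBlocks (𝟘 ∷ w) = tailBlocks w
tailBlocks (𝟙 ∷ w) = tailBlocks w
tailBlocks (𝟚 ∷ w) = headBlock w ∷ tailBlocks w

blocks≡headBlock∷tailBlocks : ∀ w → blocks w ≡ headBlock w ∷ tailBlocks w
blocks≡headBlock∷tailBlocks []      = refl
blocks≡headBlock∷tailBlocks (𝟘 ∷ w) rewrite blocks≡headBlock∷tailBlocks w = refl
blocks≡headBlock∷tailBlocks (𝟙 ∷ w) rewrite blocks≡headBlock∷tailBlocks w = refl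
blocks≡headBlock∷tailBlocks (𝟚 ∷ w) = cong ([] ∷_) (blocks≡headBlock∷tailBlocks w)

headBlock-counts≤length : ∀ w → zeros (headBlock w) + ones (headBlock w) + twos w ≤ length w
headBlock-counts≤length []      = z≤n
headBlock-counts≤length (𝟘 ∷ w) = s≤s (headBlock-counts≤length w)
headBlock-counts≤length (𝟙 ∷ w) =
  subst (_≤ suc (length w)) (cong (_+ twos w) (sym (+-suc (zeros (headBlock w)) _)))
        (s≤s (headBlock-counts≤length w))
headBlock-counts≤length (𝟚 ∷ w) =
  s≤s (≤-trans (m≤n+m (twos w) _) (headBlock-counts≤length w))

profile : ℕ → ℕ → ℕ → List Letter → Bool
profile a b t w = (ones (headBlock w) ≡ᵇ b) ∧ (zeros (headBlock w) ≡ᵇ a) ∧ (twos w ≡ᵇ t)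
                ∧ does (all? balanced? (tailBlocks w))

numProfile : ℕ → ℕ → ℕ → ℕ → ℕ
numProfile m a b t = sumWords m (λ w → ⟦ profile a b t w ⟧)

good?≡profile : ∀ t w → does (good? (suc t) w) ≡ profile 0 0 (suc t) (𝟚 ∷ w)
good?≡profile t w rewrite blocks≡headBlock∷tailBlocks w = refl

profile-length : ∀ {a b t} w → T (profile a b t w) → a + b + t ≤ length w
profile-length {a} {b} {t} w p =
  let (o≡b , p′)  = Equivalence.to (T-∧ {ones h ≡ᵇ b}) p
      (z≡a , p″)  = Equivalence.to (T-∧ {zeros h ≡ᵇ a}) p′
      (tw≡t , _)  = Equivalence.to (T-∧ {twos w ≡ᵇ t}) p″
  in subst (_≤ length w)
       (cong₂ _+_ (cong₂ _+_ (≡ᵇ⇒≡ (zeros h) a z≡a) (≡ᵇ⇒≡ (ones h) b o≡b)) (≡ᵇ⇒≡ (twos w) t tw≡t))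
       (headBlock-counts≤length w)
  where h = headBlock w

no-leading-𝟘 : ∀ m b t → sumWords m (λ w → ⟦ profile 0 b t (𝟘 ∷ w) ⟧) ≡ 0
no-leading-𝟘 m b t = trans
  (sumWords-cong m λ w _ → cong ⟦_⟧ (∧-zeroʳ (ones (headBlock w) ≡ᵇ b)))
  (sumWords-zero m)

numProfile-suc-suc : ∀ m a b t →
  numProfile (suc m) (suc a) (suc b) t ≡ numProfile m a (suc b) t + numProfile m (suc a) b t
numProfile-suc-suc m a b t = begin
  numProfile (suc m) (suc a) (suc b) t ≡⟨ sumWords-suc m (λ w → ⟦ profile (suc a) (suc b) t w ⟧) ⟩
  X + Y + sumWords m (λ _ → 0)         ≡⟨ cong (X + Y +_) (sumWords-zero m) ⟩
  X + Y + 0                            ≡⟨ +-identityʳ (X + Y) ⟩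
  X + Y                                ∎
  where X = numProfile m a (suc b) t
        Y = numProfile m (suc a) b t

numProfile-suc-zero : ∀ m a t → numProfile (suc m) (suc a) 0 t ≡ numProfile m a 0 t
numProfile-suc-zero m a t = begin
  numProfile (suc m) (suc a) 0 t                  ≡⟨ sumWords-suc m (λ w → ⟦ profile (suc a) 0 t w ⟧) ⟩
  X + sumWords m (λ _ → 0) + sumWords m (λ _ → 0) ≡⟨ cong₂ (λ y z → X + y + z) (sumWords-zero m) (sumWords-zero m) ⟩
  X + 0 + 0                                       ≡⟨ trans (+-identityʳ (X + 0)) (+-identityʳ X) ⟩
  X                                               ∎
  where X = numProfile m a 0 t

numProfile-zero-suc : ∀ m b t → numProfile (suc m) 0 (suc b) t ≡ numProfile m 0 b t
numProfile-zero-suc m b t = begin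
  numProfile (suc m) 0 (suc b) t ≡⟨ sumWords-suc m (λ w → ⟦ profile 0 (suc b) t w ⟧) ⟩
  sumWords m (λ w → ⟦ profile 0 (suc b) t (𝟘 ∷ w) ⟧) + Y + sumWords m (λ _ → 0)
    ≡⟨ cong₂ (λ x z → x + Y + z) (no-leading-𝟘 m (suc b) t) (sumWords-zero m) ⟩
  0 + Y + 0                      ≡⟨ +-identityʳ Y ⟩
  Y                              ∎
  where Y = numProfile m 0 b t

numProfile-emptyHead : ∀ m t → numProfile (suc m) 0 0 t ≡ sumWords m (λ w → ⟦ profile 0 0 t (𝟚 ∷ w) ⟧)
numProfile-emptyHead m t = begin
  numProfile (suc m) 0 0 t ≡⟨ sumWords-suc m (λ w → ⟦ profile 0 0 t w ⟧) ⟩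
  sumWords m (λ w → ⟦ profile 0 0 t (𝟘 ∷ w) ⟧) + sumWords m (λ _ → 0) + S₂
    ≡⟨ cong₂ (λ x y → x + y + S₂) (no-leading-𝟘 m 0 t) (sumWords-zero m) ⟩
  S₂                       ∎
  where S₂ = sumWords m (λ w → ⟦ profile 0 0 t (𝟚 ∷ w) ⟧)

numProfile-short : ∀ {m a b t} → m < a + b + t → numProfile m a b t ≡ 0
numProfile-short {m} {a} {b} {t} m<abt = trans
  (sumWords-cong m λ w len → ⟦⟧≡0 λ p → <⇒≱ m<abt (subst (a + b + t ≤_) len (profile-length w p)))
  (sumWords-zero m)

-- The head block of w is balanced for exactly one count a of zeros (and ones).
numProfile-split : ∀ m t → numProfile (suc m) 0 0 (suc t) ≡ ∑[ a < suc m ] numProfile m a a t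
numProfile-split m t = begin
  numProfile (suc m) 0 0 (suc t)                        ≡⟨ numProfile-emptyHead m (suc t) ⟩
  sumWords m (λ w → ⟦ profile 0 0 (suc t) (𝟚 ∷ w) ⟧)   ≡⟨ sumWords-cong m split ⟩
  sumWords m (λ w → ∑[ a < suc m ] ⟦ profile a a t w ⟧)
    ≡⟨ sumWords-∑ m (suc m) (λ a w → ⟦ profile a a t w ⟧) ⟩
  ∑[ a < suc m ] numProfile m a a t                     ∎
  where
  split : ∀ w → length w ≡ m → ⟦ profile 0 0 (suc t) (𝟚 ∷ w) ⟧ ≡ ∑[ a < suc m ] ⟦ profile a a t w ⟧
  split w len = begin
    ⟦ (twos w ≡ᵇ t) ∧ (zeros h ≡ᵇ ones h) ∧ R ⟧ ≡⟨ cong ⟦_⟧ (∧-swap (twos w ≡ᵇ t) _ R) ⟩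
    ⟦ (zeros h ≡ᵇ ones h) ∧ (twos w ≡ᵇ t) ∧ R ⟧
      ≡⟨ ∑-delta (suc m) (ones h) (λ a → (zeros h ≡ᵇ a) ∧ (twos w ≡ᵇ t) ∧ R) ones<suc-m ⟨
    ∑[ a < suc m ] ⟦ profile a a t w ⟧         ∎
    where
    h = headBlock w
    R = does (all? balanced? (tailBlocks w))
    ∧-swap : ∀ x y z → x ∧ y ∧ z ≡ y ∧ x ∧ z
    ∧-swap x y z = trans (sym (∧-assoc x y z)) (trans (cong (_∧ z) (∧-comm x y)) (∧-assoc y x z))
    ones<suc-m : ones h < suc m
    ones<suc-m = s≤s (subst (ones h ≤_) len
      (≤-trans (m≤n+m (ones h) (zeros h)) (≤-trans (m≤m+n _ (twos w)) (headBlock-counts≤length w))))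

numProfile-goodWords : ∀ m t → numProfile (suc m) 0 0 (suc t) ≡ numGoodWords (suc t) m
numProfile-goodWords m t = begin
  numProfile (suc m) 0 0 (suc t)                       ≡⟨ numProfile-emptyHead m (suc t) ⟩
  sumWords m (λ w → ⟦ profile 0 0 (suc t) (𝟚 ∷ w) ⟧)  ≡⟨ sumWords-cong m (λ w _ → cong ⟦_⟧ (good?≡profile t w)) ⟨
  sumWords m (λ w → ⟦ does (good? (suc t) w) ⟧)        ≡⟨ numGoodWords-sumWords (suc t) m ⟨
  numGoodWords (suc t) m                               ∎

-- The head block is an arbitrary arrangement of its a zeros and b ones.
numProfile-headBlock : ∀ a b r t → numProfile (a + b + r) a b t ≡ ((a + b) C a) * numProfile r 0 0 t
numProfile-headBlock zero    zero    r t = sym (*-identityˡ (numProfile r 0 0 t))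
numProfile-headBlock (suc a) zero    r t = begin
  numProfile (suc (a + 0 + r)) (suc a) 0 t ≡⟨ numProfile-suc-zero (a + 0 + r) a t ⟩
  numProfile (a + 0 + r) a 0 t             ≡⟨ numProfile-headBlock a zero r t ⟩
  ((a + 0) C a) * X                        ≡⟨ cong (_* X) (trans (n+0Cn≡1 a) (sym (n+0Cn≡1 (suc a)))) ⟩
  ((suc a + 0) C suc a) * X                ∎
  where X = numProfile r 0 0 t
        n+0Cn≡1 : ∀ n → (n + 0) C n ≡ 1
        n+0Cn≡1 n = trans (cong (_C n) (+-identityʳ n)) (nCn≡1 n)
numProfile-headBlock zero    (suc b) r t =
  trans (numProfile-zero-suc (b + r) b t) (numProfile-headBlock zero b r t)
numProfile-headBlock (suc a) (suc b) r t = begin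
  numProfile (suc (a + suc b + r)) (suc a) (suc b) t
    ≡⟨ numProfile-suc-suc (a + suc b + r) a b t ⟩
  numProfile (a + suc b + r) a (suc b) t + numProfile (a + suc b + r) (suc a) b t
    ≡⟨ cong (λ n → numProfile (a + suc b + r) a (suc b) t + numProfile (n + r) (suc a) b t) (+-suc a b) ⟩
  numProfile (a + suc b + r) a (suc b) t + numProfile (suc a + b + r) (suc a) b t
    ≡⟨ cong₂ _+_ (numProfile-headBlock a (suc b) r t) (numProfile-headBlock (suc a) b r t) ⟩
  ((a + suc b) C a) * X + ((suc a + b) C suc a) * X
    ≡⟨ *-distribʳ-+ X ((a + suc b) C a) _ ⟨
  ((a + suc b) C a + (suc a + b) C suc a) * X
    ≡⟨ cong (λ n → ((a + suc b) C a + n C suc a) * X) (+-suc a b) ⟨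
  ((a + suc b) C a + (a + suc b) C suc a) * X
    ≡⟨ cong (_* X) (nCk+nC[k+1]≡[n+1]C[k+1] (a + suc b) a) ⟩
  ((suc a + suc b) C suc a) * X ∎
  where X = numProfile r 0 0 t

f₀-suc : ∀ a → f₀ (suc a) ≡ (a + a) C a
f₀-suc a = cong (_C a) (trans (cong (_∸ 1) (+-suc a (a + 0))) (cong (a +_) (+-identityʳ a)))

weight : List ℕ → ℕ
weight is = product (map f₀ is)

sum-weight-cons : ∀ i (iss : List (List ℕ)) →
                  sum (map weight (map (i ∷_) iss)) ≡ f₀ i * sum (map weight iss)
sum-weight-cons i []         = sym (*-zeroʳ (f₀ i))
sum-weight-cons i (is ∷ iss) =
  trans (cong (f₀ i * weight is +_) (sum-weight-cons i iss)) (sym (*-distribˡ-+ (f₀ i) _ _))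

sum-map-applyUpTo : ∀ (g f : ℕ → ℕ) n → sum (map g (applyUpTo f n)) ≡ ∑[ i < n ] g (f i)
sum-map-applyUpTo g f zero    = refl
sum-map-applyUpTo g f (suc n) = cong (g (f 0) +_) (sum-map-applyUpTo g (f ∘ suc) n)

compositions-suc : ∀ n k → compositions n (suc k) ≡
  concatMap (λ i → map (suc i ∷_) (compositions (n ∸ suc i) k)) (filter (λ i → suc i ≤? n) (upTo n))
compositions-suc zero    k = refl
compositions-suc (suc n) k = refl

c₁-suc : ∀ n k → c₁ n (suc k) ≡ ∑[ i < n ] f₀ (suc i) * c₁ (n ∸ suc i) k
c₁-suc n k = begin
  sum (map weight (compositions n (suc k)))
    ≡⟨ cong (sum ∘ map weight) (compositions-suc n k) ⟩
  sum (map weight (concatMap parts firstParts))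
    ≡⟨ sum-map-concatMap weight parts firstParts ⟩
  sum (map (λ i → sum (map weight (parts i))) firstParts)
    ≡⟨ cong (sum ∘ map (sum ∘ map weight ∘ parts)) (filter-all (λ i → suc i ≤? n) (all-upTo n)) ⟩
  sum (map (λ i → sum (map weight (parts i))) (upTo n))
    ≡⟨ sum-map-applyUpTo _ (λ i → i) n ⟩
  ∑[ i < n ] sum (map weight (parts i))
    ≡⟨ ∑-cong n (λ {i} _ → sum-weight-cons (suc i) (compositions (n ∸ suc i) k)) ⟩
  ∑[ i < n ] f₀ (suc i) * c₁ (n ∸ suc i) k ∎
  where
  firstParts : List ℕ
  firstParts = filter (λ i → suc i ≤? n) (upTo n)
  parts : ℕ → List (List ℕ)
  parts i = map (suc i ∷_) (compositions (n ∸ suc i) k)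

c₁-short : ∀ {n k} → n < k → c₁ n k ≡ 0
c₁-short {zero}  {suc k} _          = refl
c₁-short {suc n} {suc k} (s≤s n<k) = trans (c₁-suc (suc n) k) (∑-vanish (suc n) λ {i} _ →
  trans (cong (f₀ (suc i) *_) (c₁-short (≤-<-trans (m∸n≤m n i) n<k))) (*-zeroʳ (f₀ (suc i))))

-- With n = k + j, numProfile (k + 2j) 0 0 k counts the words 2 ∷ w for the good words w
-- of length 2n − k − 1 when k ≥ 1, and just the empty word when k = 0, like c₁ n 0.
c₁≡numProfile : ∀ k j → c₁ (k + j) k ≡ numProfile (k + (j + j)) 0 0 k
c₁≡numProfile zero    zero    = refl
c₁≡numProfile zero    (suc j) =
  sym (trans (numProfile-emptyHead (j + suc j) 0) (sumWords-zero (j + suc j)))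
c₁≡numProfile (suc k) j = begin
  c₁ (suc k + j) (suc k)                              ≡⟨ c₁-suc (suc k + j) k ⟩
  ∑[ i < suc k + j ] f₀ (suc i) * c₁ (k + j ∸ i) k    ≡⟨ ∑-truncate _ (s≤s (m≤n+m j k)) c₁-vanish ⟩
  ∑[ i < suc j ] f₀ (suc i) * c₁ (k + j ∸ i) k        ≡⟨ ∑-cong (suc j) term ⟩
  ∑[ i < suc j ] numProfile m i i k                   ≡⟨ ∑-truncate _ (s≤s j≤m) profile-vanish ⟨
  ∑[ i < suc m ] numProfile m i i k                   ≡⟨ numProfile-split m k ⟨
  numProfile (suc m) 0 0 (suc k)                      ∎
  where
  m = k + (j + j)
  j≤m : j ≤ m
  j≤m = ≤-trans (m≤m+n j j) (m≤n+m (j + j) k)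
  c₁-vanish : ∀ {i} → suc j ≤ i → i < suc k + j → f₀ (suc i) * c₁ (k + j ∸ i) k ≡ 0
  c₁-vanish {i} j<i (s≤s i≤k+j) = trans
    (cong (f₀ (suc i) *_) (c₁-short (subst (k + j ∸ i <_) (m+n∸n≡m k j) (∸-monoʳ-< j<i i≤k+j))))
    (*-zeroʳ (f₀ (suc i)))
  profile-vanish : ∀ {i} → suc j ≤ i → i < suc m → numProfile m i i k ≡ 0
  profile-vanish {i} j<i _ = numProfile-short
    (subst (m <_) (+-comm k (i + i)) (+-monoʳ-< k (+-mono-< j<i j<i)))
  term : ∀ {i} → i < suc j → f₀ (suc i) * c₁ (k + j ∸ i) k ≡ numProfile m i i k
  term {i} (s≤s i≤j) with m≤n⇒∃[o]m+o≡n i≤j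
  ... | r , refl = begin
    f₀ (suc i) * c₁ (k + (i + r) ∸ i) k
      ≡⟨ cong₂ _*_ (f₀-suc i) (cong (λ n → c₁ n k) k+[i+r]∸i≡k+r) ⟩
    ((i + i) C i) * c₁ (k + r) k                  ≡⟨ cong (((i + i) C i) *_) (c₁≡numProfile k r) ⟩
    ((i + i) C i) * numProfile (k + (r + r)) 0 0 k ≡⟨ numProfile-headBlock i i (k + (r + r)) k ⟨
    numProfile (i + i + (k + (r + r))) i i k      ≡⟨ cong (λ n → numProfile n i i k) (length-split i r k) ⟩
    numProfile (k + ((i + r) + (i + r))) i i k    ∎
    where
    k+[i+r]∸i≡k+r : k + (i + r) ∸ i ≡ k + r
    k+[i+r]∸i≡k+r = trans (cong (_∸ i) (+-exchange k i r)) (m+n∸m≡n i (k + r))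
      where +-exchange : ∀ k i r → k + (i + r) ≡ i + (k + r)
            +-exchange = solve-∀
    length-split : ∀ i r k → i + i + (k + (r + r)) ≡ k + ((i + r) + (i + r))
    length-split = solve-∀

mainTheorem13 : (n k : ℕ) → 1 ≤ k → k ≤ n →
    c₁ n k ≡ numGoodWords k (2 * n ∸ k ∸ 1)
mainTheorem13 n zero    ()
mainTheorem13 n (suc t) _ k≤n with m≤n⇒∃[o]m+o≡n k≤n
... | j , refl = begin
  c₁ (suc t + j) (suc t)                           ≡⟨ c₁≡numProfile (suc t) j ⟩
  numProfile (suc (t + (j + j))) 0 0 (suc t)       ≡⟨ numProfile-goodWords (t + (j + j)) t ⟩
  numGoodWords (suc t) (t + (j + j))               ≡⟨ cong (numGoodWords (suc t)) length≡ ⟨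
  numGoodWords (suc t) (2 * (suc t + j) ∸ suc t ∸ 1) ∎
  where
  double : ∀ t j → 2 * (suc t + j) ≡ suc t + suc (t + (j + j))
  double = solve-∀
  length≡ : 2 * (suc t + j) ∸ suc t ∸ 1 ≡ t + (j + j)
  length≡ = cong (_∸ 1) (trans (cong (_∸ suc t) (double t j)) (m+n∸m≡n (suc t) _))
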